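{- Let $G_1,G_2$ be graphs, let $g_k\in V(G_1)$ be a vertex that is not a dominating vertex of $G_1$, and let $\psi\in\mathrm{Aut}(G_2)$ be a non-identity automorphism. Define $\lambda:V(G_1*G_2)\to V(G_1*G_2)$ by $\lambda(g_k,b)=(g_k,\psi(b))$ for all $b\in V(G_2)$, and $\lambda(a,b)=(a,b)$ for all $a\in V(G_1)\setminus\{g_k\}$, $b\in V(G_2)$. Then $\lambda$ is an automorphism of $G_1*G_2$ if and only if for every vertex $b\in V(G_2)$ we have $N_{G_2}(b)=N_{G_2}(\psi(b))$ (i.e. every vertex moved by $\psi$ and its image are false twins in $G_2$).
   Context: All graphs are finite and simple. For graphs $G_1,G_2$, the co-normal product $G_1*G_2$ is the graph with vertex set $V(G_1)\times V(G_2)$ in which $(a,b)$ and $(c,d)$ are adjacent if and only if $a$ is adjacent to $c$ in $G_1$ or $b$ is adjacent to $d$ in $G_2$. A dominating vertex of a graph $G$ is a vertex of degree $|V(G)|-1$. $N_G(v)$ is the open neighborhood of $v$. Two distinct vertices $u,v$ are false twins if $N(u)=N(v)$. -}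

module Defs where

open import Data.Nat using (ℕ)
open import Data.Fin using (Fin; _≟_)
open import Data.Product using (_×_; _,_; ∃; Σ)
open import Data.Sum using (_⊎_)
open import Data.Empty using (⊥)
open import Relation.Nullary using (¬_; yes; no)
open import Relation.Binary.PropositionalEquality using (_≡_; _≢_)
open import Function.Bundles using (_⇔_; _↔_)
open import Level using (0ℓ)

record Graph (n : ℕ) : Set₁ where
  field
    Adj   : Fin n → Fin n → Set
    irrefl : ∀ u → ¬ Adj u u
    sym    : ∀ {u v} → Adj u v → Adj v u
open Graph public

record IsAutomorphism {n : ℕ} (G : Graph n) (f : Fin n → Fin n) : Set where
  field
    bijective : ∃ λ (g : Fin n → Fin n) → (∀ x → g (f x) ≡ x) × (∀ y → f (g y) ≡ y)
    preserves : ∀ u v → Adj G u v ⇔ Adj G (f u) (f v)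

_*ᶜ_ : ∀ {n m} → Graph n → Graph m → (Fin n × Fin m → Fin n × Fin m → Set)
(G₁ *ᶜ G₂) (a , b) (c , d) = Adj G₁ a c ⊎ Adj G₂ b d

record IsConormalAut {n m : ℕ} (G₁ : Graph n) (G₂ : Graph m)
         (f : Fin n × Fin m → Fin n × Fin m) : Set where
  field
    bijective : ∃ λ (g : Fin n × Fin m → Fin n × Fin m) →
                  (∀ x → g (f x) ≡ x) × (∀ y → f (g y) ≡ y)
    preserves : ∀ u v → (G₁ *ᶜ G₂) u v ⇔ (G₁ *ᶜ G₂) (f u) (f v)

IsDominating : ∀ {n} → Graph n → Fin n → Set
IsDominating G v = ∀ u → u ≢ v → Adj G v u

SameNbhd : ∀ {n} → Graph n → Fin n → Fin n → Set
SameNbhd G u v = ∀ x → Adj G u x ⇔ Adj G v x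

liftAt : ∀ {n m} → Fin n → (Fin m → Fin m) → Fin n × Fin m → Fin n × Fin m
liftAt gₖ ψ (a , b) with a ≟ gₖ
... | yes _ = (a , ψ b)
... | no  _ = (a , b)

module Submission where

-- (⇐) λ is invertible, with inverse the lift of ψ⁻¹ (`liftAt-inverse`).
--     Adjacency of (a , b) and (c , d) is Adj₁ a c ⊎ Adj₂ b d; λ leaves the
--     first disjunct alone and changes the second according to which of
--     a, c equals gₖ: both — ψ preserves adjacency; exactly one — the twin
--     hypothesis (used symmetrically via `sameNbhd-flip`); none — nothing.
-- (⇒) Applying "λ preserves adjacency" to (gₖ , b) and (u , x) with u ≠ gₖ
--     gives (Adj₁ gₖ u ⊎ Adj₂ b x) ⇔ (Adj₁ gₖ u ⊎ Adj₂ (ψ b) x) for all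
--     such u (`lift-off-fibre`). Since gₖ is not dominating, some u ≠ gₖ is
--     non-adjacent to gₖ, so the first disjunct can be cancelled
--     (`nonDominating-cancel`). Constructively, finding that u is replaced by
--     a finite search over Fin n (`finite-∀⊎`).

open import Defs
open import Data.Nat using (ℕ; zero; suc)
open import Data.Fin using (Fin; _≟_)
import Data.Fin as Fin
open import Data.Product using (∃; _,_; proj₁; proj₂)
open import Data.Sum using (_⊎_; inj₁; inj₂)
open import Data.Sum.Function.Propositional using (_⊎-⇔_)
open import Data.Empty using (⊥-elim)
open import Relation.Nullary using (¬_; yes; no)
open import Relation.Binary.PropositionalEquality using (_≢_; _≡_; refl; cong; module ≡-Reasoning)
open import Function.Bundles using (_⇔_; mk⇔; Equivalence)
import Function.Properties.Equivalence as ⇔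

open Equivalence using (to; from)

-- Finite choice for a disjunction: if every u : Fin n satisfies A u or the
-- fixed proposition S, then S holds or all u satisfy A.  (No decidability of
-- A or S is needed, since we may inspect each given proof.)
finite-∀⊎ : ∀ {n} {S : Set} {A : Fin n → Set} →
            (∀ u → A u ⊎ S) → S ⊎ (∀ u → A u)
finite-∀⊎ {zero} f = inj₂ λ ()
finite-∀⊎ {suc n} {A = A} f with f Fin.zero
... | inj₂ s = inj₁ s
... | inj₁ a with finite-∀⊎ {A = λ u → A (Fin.suc u)} (λ u → f (Fin.suc u))
...   | inj₁ s = inj₁ s
...   | inj₂ g = inj₂ λ { Fin.zero → a ; (Fin.suc u) → g u }

module _ {n : ℕ} (G : Graph n) {g : Fin n} (ndom : ¬ IsDominating G g) where

  -- A non-dominating vertex g cancels from disjunctions: if adding "g ~ u"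
  -- turns P into Q for every u ≠ g, then P implies Q.  Otherwise every u ≠ g
  -- would be adjacent to g.
  nonDominating-cancelᵗᵒ : ∀ {P Q : Set} →
    (∀ u → u ≢ g → Adj G g u ⊎ P → Adj G g u ⊎ Q) → P → Q
  nonDominating-cancelᵗᵒ {Q = Q} h p with finite-∀⊎ {S = Q} adjacentOr
    where
    adjacentOr : ∀ u → (u ≢ g → Adj G g u) ⊎ Q
    adjacentOr u with u ≟ g
    ... | yes u≡g = inj₁ λ u≢g → ⊥-elim (u≢g u≡g)
    ... | no  u≢g with h u u≢g (inj₂ p)
    ...   | inj₁ adj = inj₁ λ _ → adj
    ...   | inj₂ q   = inj₂ q
  ... | inj₁ q   = q
  ... | inj₂ dom = ⊥-elim (ndom dom)

  nonDominating-cancel : ∀ {P Q : Set} →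
    (∀ u → u ≢ g → (Adj G g u ⊎ P) ⇔ (Adj G g u ⊎ Q)) → P ⇔ Q
  nonDominating-cancel h =
    mk⇔ (nonDominating-cancelᵗᵒ λ u u≢g → to   (h u u≢g))
        (nonDominating-cancelᵗᵒ λ u u≢g → from (h u u≢g))

module _ {n m : ℕ} (g : Fin n) (f : Fin m → Fin m) where

  liftAt-on : ∀ {a} b → a ≡ g → liftAt g f (a , b) ≡ (a , f b)
  liftAt-on {a} b a≡g with a ≟ g
  ... | yes _   = refl
  ... | no  a≢g = ⊥-elim (a≢g a≡g)

  liftAt-off : ∀ {a} b → a ≢ g → liftAt g f (a , b) ≡ (a , b)
  liftAt-off {a} b a≢g with a ≟ g
  ... | yes a≡g = ⊥-elim (a≢g a≡g)
  ... | no  _   = refl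

liftAt-inverse : ∀ {n m} (g : Fin n) {f h : Fin m → Fin m} →
                 (∀ b → f (h b) ≡ b) → ∀ x → liftAt g f (liftAt g h x) ≡ x
liftAt-inverse g {f} {h} fh (a , b) with a ≟ g
... | yes a≡g = begin
  liftAt g f (a , h b)  ≡⟨ liftAt-on g f (h b) a≡g ⟩
  (a , f (h b))         ≡⟨ cong (a ,_) (fh b) ⟩
  (a , b)               ∎
  where open ≡-Reasoning
... | no a≢g = liftAt-off g f b a≢g

sameNbhd-flip : ∀ {m} (G : Graph m) {x y : Fin m} →
                SameNbhd G x y → ∀ z → Adj G z x ⇔ Adj G z y
sameNbhd-flip G same z =
  mk⇔ (λ zx → Graph.sym G (to   (same z) (Graph.sym G zx)))
      (λ zy → Graph.sym G (from (same z) (Graph.sym G zy)))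

module _ {n m : ℕ} (G₁ : Graph n) (G₂ : Graph m) (g : Fin n) (ψ : Fin m → Fin m) where

  lift-preserves : IsAutomorphism G₂ ψ → (∀ b → SameNbhd G₂ b (ψ b)) →
    ∀ u v → (G₁ *ᶜ G₂) u v ⇔ (G₁ *ᶜ G₂) (liftAt g ψ u) (liftAt g ψ v)
  lift-preserves aut twins (a , b) (c , d) with a ≟ g | c ≟ g
  ... | yes _ | yes _ = ⇔.refl ⊎-⇔ IsAutomorphism.preserves aut b d
  ... | yes _ | no  _ = ⇔.refl ⊎-⇔ twins b d
  ... | no  _ | yes _ = ⇔.refl ⊎-⇔ sameNbhd-flip G₂ (twins d) b
  ... | no  _ | no  _ = ⇔.refl

  lift-isConormalAut : IsAutomorphism G₂ ψ → (∀ b → SameNbhd G₂ b (ψ b)) →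
                       IsConormalAut G₁ G₂ (liftAt g ψ)
  lift-isConormalAut aut twins = record
    { bijective = liftAt g ψ⁻¹ , liftAt-inverse g ψ⁻¹∘ψ , liftAt-inverse g ψ∘ψ⁻¹
    ; preserves = lift-preserves aut twins
    }
    where
    open IsAutomorphism aut using (bijective)
    ψ⁻¹ = proj₁ bijective
    ψ⁻¹∘ψ = proj₁ (proj₂ bijective)
    ψ∘ψ⁻¹ = proj₂ (proj₂ bijective)

  lift-off-fibre : IsConormalAut G₁ G₂ (liftAt g ψ) → ∀ b x u → u ≢ g →
    (Adj G₁ g u ⊎ Adj G₂ b x) ⇔ (Adj G₁ g u ⊎ Adj G₂ (ψ b) x)
  lift-off-fibre c b x u u≢g
    with g ≟ g | u ≟ g | IsConormalAut.preserves c (g , b) (u , x)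
  ... | yes _   | no _    | pres = pres
  ... | no g≢g  | _       | _    = ⊥-elim (g≢g refl)
  ... | yes _   | yes u≡g | _    = ⊥-elim (u≢g u≡g)

theorem2p10 : ∀ {n m : ℕ} (G₁ : Graph n) (G₂ : Graph m) (gₖ : Fin n)
    (ψ : Fin m → Fin m) →
    ¬ IsDominating G₁ gₖ →
    IsAutomorphism G₂ ψ →
    (∃ λ b → ψ b ≢ b) →
    IsConormalAut G₁ G₂ (liftAt gₖ ψ) ⇔ (∀ b → SameNbhd G₂ b (ψ b))
theorem2p10 G₁ G₂ gₖ ψ ndom aut _ = mk⇔ twinsFromAut (lift-isConormalAut G₁ G₂ gₖ ψ aut)
  where
  twinsFromAut : IsConormalAut G₁ G₂ (liftAt gₖ ψ) → ∀ b → SameNbhd G₂ b (ψ b)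
  twinsFromAut c b x = nonDominating-cancel G₁ ndom (lift-off-fibre G₁ G₂ gₖ ψ c b x)
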